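{- Let $\pi\in S_n$ and let $d$ be a tail-bound descent of $\pi$. Then \[\sum_{\sigma\in s^{ -1}(\pi)}x^{\operatorname{des}(\sigma)+1}y^{\operatorname{peak}(\sigma)+1}=\sum_{H\in\mathrm{SW}_d(\pi)}\left(\sum_{\mu\in s^{ -1}(\pi_U^H)}x^{\operatorname{des}(\mu)+1}y^{\operatorname{peak}(\mu)+1}\right)\left(\sum_{\lambda\in s^{ -1}(\pi_S^H)}x^{\operatorname{des}(\lambda)+1}y^{\operatorname{peak}(\lambda)+1}\right).\]
   Context: A permutation is an ordering of a finite set of positive integers, written in one-line notation; $S_n$ is the set of permutations of $\{1,\dots,n\}$. For $\pi=\pi_1\cdots\pi_n$, a descent is an index $i\in[n-1]$ with $\pi_i>\pi_{i+1}$, and a peak is an index $i\in\{2,\dots,n-1\}$ with $\pi_{i-1}<\pi_i>\pi_{i+1}$; $\operatorname{des}(\pi)$ and $\operatorname{peak}(\pi)$ are their numbers. Convention: the empty permutation has $0$ descents and $-1$ peaks. The stack-sorting map $s$: given an input permutation, repeatedly do the following: if the stack is empty or the next input entry is smaller than the entry on top of the stack, push the next input entry onto the stack; otherwise pop the top of the stack and append it to the output. Stop when all entries are output; $s(\pi)$ is the output. For a permutation $\tau$, $s^{ -1}(\tau)$ is the set of permutations (of the same set of entries) mapped to $\tau$ by $s$. A hook of $\pi$ is a pair of indices $i<j$ with $\pi_i<\pi_j$ (drawn from the point $(i,\pi_i)$ up and then right to $(j,\pi_j)$); $(i,\pi_i)$ is its southwest endpoint and $(j,\pi_j)$ its northeast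 endpoint. $\mathrm{SW}_i(\pi)$ is the set of hooks with southwest endpoint $(i,\pi_i)$. For such a hook $H$, $\pi_U^H=\pi_1\cdots\pi_i\pi_{j+1}\cdots\pi_n$ and $\pi_S^H=\pi_{i+1}\cdots\pi_{j-1}$. The tail length $\operatorname{tl}(\pi)$ of $\pi\in S_n$ is the smallest nonnegative integer $\ell$ with $\pi_{n-\ell}\neq n-\ell$, with the convention $\operatorname{tl}(12\cdots n)=n$. The tail of $\pi$ is the set of points $(m,m)$ for $n-\operatorname{tl}(\pi)+1\le m\le n$. A descent $d$ of $\pi$ is tail-bound if every hook in $\mathrm{SW}_d(\pi)$ has its northeast endpoint in the tail of $\pi$. -}

module Defs where

open import Level using (0ℓ)
open import Data.Nat using (ℕ; zero; suc; _+_; _∸_; _<_; _≤_; _<?_; _≟_)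
open import Data.Integer as ℤ using (ℤ; ∣_∣)
open import Data.Bool using (Bool; true; false; if_then_else_)
open import Data.List using (List; []; _∷_; _++_; take; drop; map; concatMap; filter; upTo; length)
open import Data.List.Properties using (≡-dec)
open import Data.Product using (_×_; _,_; Σ)
open import Relation.Nullary using (yes; no; Dec; ¬_)
open import Relation.Nullary.Decidable using (⌊_⌋)
open import Relation.Binary.PropositionalEquality using (_≡_)
open import Data.List.Relation.Binary.Permutation.Propositional using (_↭_)
open import Algebra.Bundles using (CommutativeSemiring)

-- Permutations are lists of (distinct positive) natural numbers in
-- one-line notation.  Positions are 1-based as in the paper.

InS : ℕ → List ℕ → Set
InS n π = π ↭ map suc (upTo n)

-- π_i (1-based); junk value 0 outside 1..length π
at : List ℕ → ℕ → ℕ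
at []      _             = 0
at (a ∷ _) (suc zero)    = a
at (_ ∷ π) (suc (suc i)) = at π (suc i)
at (_ ∷ _) zero          = 0

-- Stack-sorting map, implemented as the stack algorithm.
-- The stack is a list whose head is the top.

popWhile : ℕ → List ℕ → List ℕ × List ℕ
popWhile a [] = [] , []
popWhile a (t ∷ st) with a <? t
... | yes _ = [] , t ∷ st
... | no  _ with popWhile a st
...   | (o , r) = t ∷ o , r

stackRun : List ℕ → List ℕ → List ℕ
stackRun []      st = st
stackRun (a ∷ i) st with popWhile a st
... | (o , r) = o ++ stackRun i (a ∷ r)

s : List ℕ → List ℕ
s π = stackRun π []

des : List ℕ → ℕ
des []           = 0
des (a ∷ [])     = 0
des (a ∷ b ∷ π)  = (if ⌊ b <? a ⌋ then 1 else 0) + des (b ∷ π)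

peaksℕ : List ℕ → ℕ
peaksℕ (a ∷ b ∷ c ∷ π) =
  (if ⌊ a <? b ⌋ then (if ⌊ c <? b ⌋ then 1 else 0) else 0) + peaksℕ (b ∷ c ∷ π)
peaksℕ _ = 0

-- peak, with the convention peak(empty) = -1
peak : List ℕ → ℤ
peak []      = ℤ.-[1+ 0 ]
peak (a ∷ π) = ℤ.+ peaksℕ (a ∷ π)

-- All orderings of the entries of a list (for lists of distinct
-- entries, each ordering occurs exactly once).

insertAll : ℕ → List ℕ → List (List ℕ)
insertAll a []      = (a ∷ []) ∷ []
insertAll a (b ∷ l) = (a ∷ b ∷ l) ∷ map (b ∷_) (insertAll a l)

perms : List ℕ → List (List ℕ)
perms []      = [] ∷ []
perms (a ∷ l) = concatMap (insertAll a) (perms l)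

sInv : List ℕ → List (List ℕ)
sInv τ = filter (λ σ → ≡-dec _≟_ (s σ) τ) (perms τ)

range : ℕ → ℕ → List ℕ
range a b = map (a +_) (upTo (suc b ∸ a))

-- SW_d(π): hooks (d , j) with d < j ≤ n and π_d < π_j, listed by j
SWd : ℕ → List ℕ → ℕ → List ℕ
SWd n π d = filter (λ j → at π d <? at π j) (range (suc d) n)

IsDescent : ℕ → List ℕ → ℕ → Set
IsDescent n π d = 1 ≤ d × d < n × at π (suc d) < at π d

-- tl(π): number of consecutive fixed points counted down from n
-- (= smallest ℓ with π_{n-ℓ} ≠ n-ℓ; equals n for the identity)
tlFrom : List ℕ → ℕ → ℕ
tlFrom π zero    = 0
tlFrom π (suc k) with at π (suc k) ≟ suc k
... | yes _ = suc (tlFrom π k)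
... | no  _ = 0

tl : ℕ → List ℕ → ℕ
tl n π = tlFrom π n

InTail : ℕ → List ℕ → ℕ → Set
InTail n π j = Σ ℕ λ m → (n ∸ tl n π) + 1 ≤ m × m ≤ n × j ≡ m × at π j ≡ m

TailBoundDescent : ℕ → List ℕ → ℕ → Set
TailBoundDescent n π d =
  IsDescent n π d ×
  (∀ j → d < j → j ≤ n → at π d < at π j → InTail n π j)

πU : List ℕ → ℕ → ℕ → List ℕ
πU π d j = take d π ++ drop j π

πS : List ℕ → ℕ → ℕ → List ℕ
πS π d j = drop d (take (j ∸ 1) π)

-- Polynomials in x, y with ℕ coefficients, evaluated in an arbitrary
-- commutative semiring (an identity holding for all x, y in all
-- commutative semirings is exactly an identity in ℕ[x,y]).

module Poly (R : CommutativeSemiring 0ℓ 0ℓ) where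
  open CommutativeSemiring R renaming (_+_ to _⊕_; _*_ to _⊗_)

  pow : Carrier → ℕ → Carrier
  pow x zero    = 1#
  pow x (suc k) = x ⊗ pow x k

  sumR : List Carrier → Carrier
  sumR []      = 0#
  sumR (a ∷ l) = a ⊕ sumR l

  F : Carrier → Carrier → List ℕ → Carrier
  F x y τ = sumR (map (λ σ → pow x (des σ + 1) ⊗ pow y ∣ peak σ ℤ.+ ℤ.+ 1 ∣) (sInv τ))

module Submission where

-- Write F(τ) = ∑_{σ ∈ s⁻¹(τ)} x^{des σ + 1} y^{peak σ + 1}.  If d is a tail-bound
-- descent of π ∈ Sₙ, then π = P B X: P = π₁…π_d ends with p = π_d, the block
-- B = π_{d+1}…π_c (c = n − tl π) is nonempty with entries below p, and X is the
-- tail (c+1)…n.  The hooks in SW_d(π) end exactly at the entries j of X = u j w,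
-- with π_U = P w and π_S = B u, so the theorem reads
--   F(P B X) = ∑_{X = u j w} F(P w) F(B u).
-- This is proved by induction on X (for all nonempty suffixes of P at once) from
-- two facts about the largest entry m of a permutation: s(L m R) = s(L) s(R) m,
-- which yields F(τ m) = ∑_{τ = u v} F(u) F₁(v) with F₁ = F except F₁([]) = 1; and
-- the last entry of s(σ) is the maximum of σ, so F(τ) = 0 unless τ ends with it.

open import Defs
open import Level using (0ℓ)
open import Algebra.Bundles using (CommutativeSemiring)
open import Data.Nat using (ℕ; zero; suc; _+_; _∸_; _⊓_; _<_; _≤_; _<?_; _≟_; z≤n; s≤s)
import Data.Nat.Properties as ℕ
open import Relation.Binary.Definitions using (tri<; tri≈; tri>)
open import Data.Integer as ℤ using (∣_∣)
open import Data.Bool using (Bool; true; false; if_then_else_)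
open import Relation.Nullary.Decidable using (⌊_⌋)
open import Data.List
  using (List; []; _∷_; _++_; map; concatMap; [_]; length; take; drop; filter; upTo; applyUpTo; initLast; _∷ʳ′_)
open import Data.List.Properties
  using ( ++-assoc; ++-identityʳ; ++-cancelˡ; ∷-injective; ∷ʳ-injective; map-∘; map-upTo; ≡-dec
        ; length-++; length-map; length-upTo; length-take; length-drop; take++drop≡id
        ; filter-++; filter-none; filter-all )
open import Data.List.Membership.Propositional using (_∈_; _∉_; find; lose)
open import Data.List.Membership.Propositional.Properties
  using (∈-++⁺ˡ; ∈-++⁺ʳ; ∈-map⁺; ∈-map⁻; ∈-∃++; ∈-concatMap⁺; ∈-concatMap⁻; ∈-filter⁺; ∈-filter⁻; ∈-upTo⁻)
open import Data.List.Membership.Propositional.Properties.WithK using (unique∧set⇒bag)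
open import Data.List.Relation.Unary.Any using (here; there)
open import Data.List.Relation.Unary.All as All using (All; []; _∷_)
import Data.List.Relation.Unary.All.Properties as All
open import Data.List.Relation.Unary.AllPairs as AllPairs using (AllPairs; []; _∷_)
open import Data.List.Relation.Unary.Unique.Propositional using (Unique)
import Data.List.Relation.Unary.Unique.Propositional.Properties as Unique
open import Data.List.Relation.Binary.BagAndSetEquality using (∼bag⇒↭)
open import Data.List.Relation.Binary.Permutation.Propositional
  using (_↭_; prep; ↭-refl; ↭-sym; ↭-trans; ↭-reflexive; ↭⇒↭ₛ)
import Data.List.Relation.Binary.Permutation.Propositional.Properties as Perm
import Data.List.Relation.Binary.Permutation.Setoid.Properties as PermₛProps
open import Data.Product using (∃-syntax; _×_; _,_; proj₁; proj₂; map₁)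
open import Data.Empty using (⊥; ⊥-elim)
open import Data.Sum using (inj₁; inj₂; [_,_]′)
open import Data.List.Extrema.Nat using (max; argmax-sel; ⊥≤max; xs≤max)
open import Function using (id)
open import Relation.Nullary using (¬_; yes; no)
open import Relation.Binary.PropositionalEquality
  using (_≡_; _≢_; refl; sym; trans; cong; cong₂; subst; subst₂; module ≡-Reasoning)
import Relation.Binary.PropositionalEquality as ≡
open import Function.Bundles using (mk⇔)

module _ {A : Set} where

  AllPairs-++ˡ : ∀ {R : A → A → Set} (u : List A) {v} → AllPairs R (u ++ v) → AllPairs R u
  AllPairs-++ˡ []      _       = []
  AllPairs-++ˡ (a ∷ u) (h ∷ p) = All.++⁻ˡ u h ∷ AllPairs-++ˡ u p

  AllPairs-++ʳ : ∀ {R : A → A → Set} (u : List A) {v} → AllPairs R (u ++ v) → AllPairs R v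
  AllPairs-++ʳ []      p       = p
  AllPairs-++ʳ (a ∷ u) (_ ∷ p) = AllPairs-++ʳ u p

  unique-mid : ∀ {x : A} u {v} → Unique (u ++ x ∷ v) → x ∉ u ++ v
  unique-mid []      (x≢ ∷ _) x∈v       = All.lookup x≢ x∈v refl
  unique-mid (b ∷ u) (b≢ ∷ _) (here x≡b) = All.lookup b≢ (∈-++⁺ʳ u (here refl)) (sym x≡b)
  unique-mid (b ∷ u) (_ ∷ p)  (there x∈) = unique-mid u p x∈

  unique-disjoint : ∀ (u : List A) {v e} → Unique (u ++ v) → e ∈ u → e ∈ v → ⊥
  unique-disjoint (a ∷ u) (a≢ ∷ _) (here refl) e∈v = All.lookup a≢ (∈-++⁺ʳ u e∈v) refl
  unique-disjoint (a ∷ u) (_ ∷ p)  (there e∈u) e∈v = unique-disjoint u p e∈u e∈v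

  unique-↭ : ∀ {xs ys : List A} → Unique xs → Unique ys →
    (∀ {z} → z ∈ xs → z ∈ ys) → (∀ {z} → z ∈ ys → z ∈ xs) → xs ↭ ys
  unique-↭ uxs uys to from = ∼bag⇒↭ (unique∧set⇒bag uxs uys (mk⇔ to from))

  unique-resp-↭ : ∀ {xs ys : List A} → xs ↭ ys → Unique xs → Unique ys
  unique-resp-↭ p = PermₛProps.Unique-resp-↭ (≡.setoid A) (↭⇒↭ₛ p)

  ++-∷-injective : ∀ {m : A} L {R} L' {R'} → m ∉ L → m ∉ L' →
    L ++ m ∷ R ≡ L' ++ m ∷ R' → L ≡ L' × R ≡ R'
  ++-∷-injective []      []        _ _  refl = refl , refl
  ++-∷-injective []      (b ∷ L')  _ m∉ refl = ⊥-elim (m∉ (here refl))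
  ++-∷-injective (b ∷ L) []        m∉ _ refl = ⊥-elim (m∉ (here refl))
  ++-∷-injective (b ∷ L) (b' ∷ L') m∉ m∉' eq with ∷-injective eq
  ... | refl , eq' with ++-∷-injective L L' (λ q → m∉ (there q)) (λ q → m∉' (there q)) eq'
  ...   | refl , refl = refl , refl

module _ {A B : Set} (f : A → List B) where

  ∈-concatMap-intro : ∀ {xs a b} → a ∈ xs → b ∈ f a → b ∈ concatMap f xs
  ∈-concatMap-intro a∈ b∈ = ∈-concatMap⁺ f (lose a∈ b∈)

  ∈-concatMap-elim : ∀ xs {b} → b ∈ concatMap f xs → ∃[ a ] (a ∈ xs × b ∈ f a)
  ∈-concatMap-elim xs b∈ = find (∈-concatMap⁻ f {xs = xs} b∈)

  unique-concatMap : ∀ xs → Unique xs → (∀ {a} → a ∈ xs → Unique (f a)) →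
    (∀ {a a' b} → a ∈ xs → a' ∈ xs → b ∈ f a → b ∈ f a' → a ≡ a') →
    Unique (concatMap f xs)
  unique-concatMap []       _          _    _    = []
  unique-concatMap (a ∷ xs) (a∉ ∷ uxs) uniq disj =
    Unique.++⁺ (uniq (here refl))
      (unique-concatMap xs uxs (λ a∈ → uniq (there a∈)) (λ a∈ a'∈ → disj (there a∈) (there a'∈)))
      separate
    where
      separate : ∀ {b} → b ∈ f a × b ∈ concatMap f xs → ⊥
      separate (b∈ , b∈') with ∈-concatMap-elim xs b∈'
      ... | a' , a'∈ , b∈'' = All.lookup a∉ a'∈ (disj (here refl) (there a'∈) b∈ b∈'')

∈-insertAll⁻ : ∀ {a σ} p → σ ∈ insertAll a p → ∃[ u ] ∃[ v ] (p ≡ u ++ v × σ ≡ u ++ a ∷ v)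
∈-insertAll⁻ []      (here refl) = [] , [] , refl , refl
∈-insertAll⁻ (b ∷ p) (here refl) = [] , b ∷ p , refl , refl
∈-insertAll⁻ (b ∷ p) (there σ∈) with ∈-map⁻ (b ∷_) σ∈
... | σ' , σ'∈ , refl with ∈-insertAll⁻ p σ'∈
...   | u , v , refl , refl = b ∷ u , v , refl , refl

∈-insertAll⁺ : ∀ {a} u v → u ++ a ∷ v ∈ insertAll a (u ++ v)
∈-insertAll⁺ []      []      = here refl
∈-insertAll⁺ []      (b ∷ v) = here refl
∈-insertAll⁺ (b ∷ u) v       = there (∈-map⁺ (b ∷_) (∈-insertAll⁺ u v))

unique-insertAll : ∀ {a} p → a ∉ p → Unique (insertAll a p)
unique-insertAll []      _  = [] ∷ []
unique-insertAll {a} (b ∷ p) a∉ =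
  All.tabulate first≢ ∷ Unique.map⁺ (λ { refl → refl }) (unique-insertAll p (λ q → a∉ (there q)))
  where
    first≢ : ∀ {σ} → σ ∈ map (b ∷_) (insertAll a p) → a ∷ b ∷ p ≢ σ
    first≢ σ∈ eq with ∈-map⁻ (b ∷_) σ∈
    ... | _ , _ , refl with eq
    ...   | refl = a∉ (here refl)

∈-perms⁻ : ∀ {σ} τ → σ ∈ perms τ → σ ↭ τ
∈-perms⁻ []      (here refl) = ↭-refl
∈-perms⁻ (a ∷ l) σ∈ with ∈-concatMap-elim (insertAll a) (perms l) σ∈
... | p , p∈ , σ∈' with ∈-insertAll⁻ p σ∈'
...   | u , v , refl , refl = ↭-trans (Perm.shift a u v) (prep a (∈-perms⁻ l p∈))

∈-perms⁺ : ∀ {σ} τ → σ ↭ τ → σ ∈ perms τ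
∈-perms⁺ []      σ↭ rewrite Perm.↭-empty-inv σ↭ = here refl
∈-perms⁺ (a ∷ l) σ↭ with ∈-∃++ (Perm.∈-resp-↭ (↭-sym σ↭) (here refl))
... | u , v , refl =
  ∈-concatMap-intro (insertAll a) (∈-perms⁺ l (Perm.drop-mid u [] σ↭)) (∈-insertAll⁺ u v)

unique-perms : ∀ τ → Unique τ → Unique (perms τ)
unique-perms []      _          = [] ∷ []
unique-perms (a ∷ l) (a∉ ∷ ul) =
  unique-concatMap (insertAll a) (perms l) (unique-perms l ul)
    (λ p∈ → unique-insertAll _ (a∉perm p∈)) sameOrigin
  where
    a∉perm : ∀ {p} → p ∈ perms l → a ∉ p
    a∉perm p∈ a∈ = All.lookup a∉ (Perm.∈-resp-↭ (∈-perms⁻ l p∈) a∈) refl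
    sameOrigin : ∀ {p p' σ} → p ∈ perms l → p' ∈ perms l →
      σ ∈ insertAll a p → σ ∈ insertAll a p' → p ≡ p'
    sameOrigin {p} {p'} p∈ p'∈ σ∈ σ∈' with ∈-insertAll⁻ p σ∈ | ∈-insertAll⁻ p' σ∈'
    ... | u , v , refl , refl | u' , v' , refl , eq
      with ++-∷-injective u u' (λ q → a∉perm p∈ (∈-++⁺ˡ q)) (λ q → a∉perm p'∈ (∈-++⁺ˡ q)) eq
    ...   | refl , refl = refl

sInv⁻ : ∀ {σ} τ → σ ∈ sInv τ → σ ↭ τ × s σ ≡ τ
sInv⁻ τ σ∈ with ∈-filter⁻ (λ σ → ≡-dec _≟_ (s σ) τ) {xs = perms τ} σ∈
... | σ∈perms , sσ≡τ = ∈-perms⁻ τ σ∈perms , sσ≡τ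

sInv⁺ : ∀ {σ} τ → σ ↭ τ → s σ ≡ τ → σ ∈ sInv τ
sInv⁺ τ σ↭ sσ≡τ = ∈-filter⁺ (λ σ → ≡-dec _≟_ (s σ) τ) (∈-perms⁺ τ σ↭) sσ≡τ

unique-sInv : ∀ τ → Unique τ → Unique (sInv τ)
unique-sInv τ uτ = Unique.filter⁺ (λ σ → ≡-dec _≟_ (s σ) τ) (unique-perms τ uτ)

popWhile-above : ∀ {M} st → All (_< M) st → popWhile M st ≡ (st , [])
popWhile-above []       _          = refl
popWhile-above {M} (t ∷ st) (t<M ∷ st<M) with M <? t
... | yes M<t = ⊥-elim (ℕ.<-asym t<M M<t)
... | no  _   rewrite popWhile-above st st<M = refl

popWhile-bottom : ∀ {a M} st → a < M →
  popWhile a (st ++ [ M ]) ≡ (proj₁ (popWhile a st) , proj₂ (popWhile a st) ++ [ M ])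
popWhile-bottom {a} {M} [] a<M with a <? M
... | yes _   = refl
... | no  a≮M = ⊥-elim (a≮M a<M)
popWhile-bottom {a} (t ∷ st) a<M with a <? t
... | yes _ = refl
... | no  _ rewrite popWhile-bottom st a<M = refl

popWhile-++ : ∀ a st → proj₁ (popWhile a st) ++ proj₂ (popWhile a st) ≡ st
popWhile-++ a []       = refl
popWhile-++ a (t ∷ st) with a <? t
... | yes _ = refl
... | no  _ = cong (t ∷_) (popWhile-++ a st)

popWhile-All : ∀ {P : ℕ → Set} a st → All P st → All P (proj₂ (popWhile a st))
popWhile-All a []       ps       = ps
popWhile-All a (t ∷ st) (p ∷ ps) with a <? t
... | yes _ = p ∷ ps
... | no  _ = popWhile-All a st ps

-- When the maximum M is read, the run so far is flushed and M stays at
-- the bottom of the stack for the rest of the run.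
stackRun-max : ∀ {M} L R st → All (_< M) L → All (_< M) st →
  stackRun (L ++ M ∷ R) st ≡ stackRun L st ++ stackRun R [ M ]
stackRun-max []      R st _ st<M rewrite popWhile-above st st<M = refl
stackRun-max (a ∷ L) R st (a<M ∷ L<M) st<M
  rewrite stackRun-max L R (a ∷ proj₂ (popWhile a st)) L<M (a<M ∷ popWhile-All a st st<M) =
  sym (++-assoc (proj₁ (popWhile a st)) _ _)

stackRun-bottom : ∀ {M} R st → All (_< M) R → stackRun R (st ++ [ M ]) ≡ stackRun R st ++ [ M ]
stackRun-bottom []      st _ = refl
stackRun-bottom (a ∷ R) st (a<M ∷ R<M) rewrite popWhile-bottom st a<M =
  trans (cong (proj₁ (popWhile a st) ++_) (stackRun-bottom R (a ∷ proj₂ (popWhile a st)) R<M))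
        (sym (++-assoc (proj₁ (popWhile a st)) _ _))

s-max : ∀ {M} L R → All (_< M) L → All (_< M) R → s (L ++ M ∷ R) ≡ s L ++ s R ++ [ M ]
s-max L R L<M R<M = trans (stackRun-max L R [] L<M []) (cong (s L ++_) (stackRun-bottom R [] R<M))

stackRun-↭ : ∀ i st → stackRun i st ↭ i ++ st
stackRun-↭ []      st = ↭-refl
stackRun-↭ (a ∷ i) st =
  ↭-trans (Perm.++⁺ˡ out (↭-trans (stackRun-↭ i (a ∷ kept)) (Perm.shift a i kept)))
  (↭-trans (Perm.shifts out (a ∷ i)) (Perm.++⁺ˡ (a ∷ i) (↭-reflexive (popWhile-++ a st))))
  where
    out  = proj₁ (popWhile a st)
    kept = proj₂ (popWhile a st)

s-↭ : ∀ σ → s σ ↭ σ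
s-↭ σ = ↭-trans (stackRun-↭ σ []) (↭-reflexive (++-identityʳ σ))

maximum : ∀ {σ e} → e ∈ σ → ∃[ M ] (M ∈ σ × All (_≤ M) σ)
maximum {a ∷ l} _ = max a l , [ here , there ]′ (argmax-sel id a l) , ⊥≤max a l ∷ xs≤max a l

s-last-max : ∀ {σ τ a} → Unique σ → s σ ≡ τ ++ [ a ] → All (_≤ a) σ
s-last-max {σ} {τ} {a} uσ sσ with maximum (Perm.∈-resp-↭ (s-↭ σ) (subst (a ∈_) (sym sσ) (∈-++⁺ʳ τ (here refl))))
... | M , M∈ , σ≤M with ∈-∃++ M∈
...   | L , R , refl = subst (λ b → All (_≤ b) (L ++ M ∷ R)) M≡a σ≤M
  where
    LR≤M : All (_≤ M) (L ++ R)
    LR≤M = All.++⁺ (All.++⁻ˡ L σ≤M) (All.tail (All.++⁻ʳ L σ≤M))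
    LR<M : All (_< M) (L ++ R)
    LR<M = All.tabulate (λ z∈ → ℕ.≤∧≢⇒< (All.lookup LR≤M z∈) (λ { refl → unique-mid L uσ z∈ }))
    M≡a : M ≡ a
    M≡a = proj₂ (∷ʳ-injective (s L ++ s R) τ
      (trans (++-assoc (s L) (s R) [ M ]) (trans (sym (s-max L R (All.++⁻ˡ L LR<M) (All.++⁻ʳ L LR<M))) sσ)))

cuts : List ℕ → List (List ℕ × List ℕ)
cuts []      = ([] , []) ∷ []
cuts (a ∷ l) = ([] , a ∷ l) ∷ map (map₁ (a ∷_)) (cuts l)

∈-cuts⁻ : ∀ {uv} τ → uv ∈ cuts τ → proj₁ uv ++ proj₂ uv ≡ τ
∈-cuts⁻ []      (here refl) = refl
∈-cuts⁻ (a ∷ l) (here refl) = refl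
∈-cuts⁻ (a ∷ l) (there uv∈) with ∈-map⁻ (map₁ (a ∷_)) uv∈
... | _ , uv∈' , refl = cong (a ∷_) (∈-cuts⁻ l uv∈')

∈-cuts⁺ : ∀ u v → (u , v) ∈ cuts (u ++ v)
∈-cuts⁺ []      []      = here refl
∈-cuts⁺ []      (b ∷ v) = here refl
∈-cuts⁺ (a ∷ u) v       = there (∈-map⁺ (map₁ (a ∷_)) (∈-cuts⁺ u v))

unique-cuts : ∀ τ → Unique (cuts τ)
unique-cuts []      = [] ∷ []
unique-cuts (a ∷ l) = All.tabulate first≢ ∷ Unique.map⁺ cons-injective (unique-cuts l)
  where
    first≢ : ∀ {uv} → uv ∈ map (map₁ (a ∷_)) (cuts l) → ([] , a ∷ l) ≢ uv
    first≢ uv∈ eq with ∈-map⁻ (map₁ (a ∷_)) uv∈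
    ... | _ , _ , refl with eq
    ...   | ()
    cons-injective : ∀ {p q : List ℕ × List ℕ} → map₁ (a ∷_) p ≡ map₁ (a ∷_) q → p ≡ q
    cons-injective refl = refl

glued : ℕ → List ℕ × List ℕ → List (List ℕ)
glued m uv = concatMap (λ L → map (λ R → L ++ m ∷ R) (sInv (proj₂ uv))) (sInv (proj₁ uv))

gluedAll : List ℕ → ℕ → List (List ℕ)
gluedAll τ m = concatMap (glued m) (cuts τ)

below-∉ : ∀ {m L} → All (_< m) L → m ∉ L
below-∉ L<m m∈ = ℕ.<-irrefl refl (All.lookup L<m m∈)

preimage-below : ∀ {m L} τ → L ∈ sInv τ → All (_< m) τ → All (_< m) L
preimage-below τ L∈ τ<m = Perm.All-resp-↭ (↭-sym (proj₁ (sInv⁻ τ L∈))) τ<m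

∈-glued⁻ : ∀ {m uv σ} → σ ∈ glued m uv →
  ∃[ L ] ∃[ R ] (L ∈ sInv (proj₁ uv) × R ∈ sInv (proj₂ uv) × σ ≡ L ++ m ∷ R)
∈-glued⁻ {m} {uv} σ∈ with ∈-concatMap-elim (λ L → map (λ R → L ++ m ∷ R) (sInv (proj₂ uv))) (sInv (proj₁ uv)) σ∈
... | L , L∈ , σ∈' with ∈-map⁻ (λ R → L ++ m ∷ R) σ∈'
...   | R , R∈ , σ≡ = L , R , L∈ , R∈ , σ≡

-- Since s(L m R) = s(L) s(R) m, the preimages of τ m are exactly the
-- glued orderings along cuts of τ, each obtained once.
module PreimagesAtMaximum (τ : List ℕ) (m : ℕ) (uτ : Unique τ) (τ<m : All (_< m) τ) where

  cut-below : ∀ {uv} → uv ∈ cuts τ → All (_< m) (proj₁ uv) × All (_< m) (proj₂ uv)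
  cut-below {uv} uv∈ = All.++⁻ (proj₁ uv) (subst (All (_< m)) (sym (∈-cuts⁻ τ uv∈)) τ<m)

  cut-unique : ∀ {uv} → uv ∈ cuts τ → Unique (proj₁ uv) × Unique (proj₂ uv)
  cut-unique {uv} uv∈ = AllPairs-++ˡ (proj₁ uv) uuv , AllPairs-++ʳ (proj₁ uv) uuv
    where uuv = subst Unique (sym (∈-cuts⁻ τ uv∈)) uτ

  gluedAll⊆ : ∀ {σ} → σ ∈ gluedAll τ m → σ ∈ sInv (τ ++ [ m ])
  gluedAll⊆ σ∈ with ∈-concatMap-elim (glued m) (cuts τ) σ∈
  ... | (u , v) , uv∈ , σ∈' with ∈-glued⁻ {m} {u , v} σ∈' | cut-below uv∈ | ∈-cuts⁻ τ uv∈
  ...   | L , R , L∈ , R∈ , refl | u<m , v<m | refl with sInv⁻ u L∈ | sInv⁻ v R∈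
  ...     | L↭ , sL | R↭ , sR =
    sInv⁺ ((u ++ v) ++ [ m ])
      (↭-trans (Perm.++⁺ L↭ (prep m R↭)) (↭-trans (Perm.shift m u v) (Perm.++-comm [ m ] (u ++ v))))
      (trans (s-max L R (preimage-below u L∈ u<m) (preimage-below v R∈ v<m))
             (trans (cong₂ (λ a b → a ++ b ++ [ m ]) sL sR) (sym (++-assoc u v [ m ]))))

  -- ... and each preimage σ of τ m is glued along the cut (s L , s R) of τ,
  -- where σ = L ++ m ∷ R.
  ⊆gluedAll : ∀ {σ} → σ ∈ sInv (τ ++ [ m ]) → σ ∈ gluedAll τ m
  ⊆gluedAll σ∈ with sInv⁻ (τ ++ [ m ]) σ∈
  ... | σ↭ , sσ with ∈-∃++ (Perm.∈-resp-↭ (↭-sym σ↭) (∈-++⁺ʳ τ (here refl)))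
  ...   | L , R , refl =
    ∈-concatMap-intro (glued m) (subst (λ t → (s L , s R) ∈ cuts t) sLsR (∈-cuts⁺ (s L) (s R)))
      (∈-concatMap-intro (λ L' → map (λ R' → L' ++ m ∷ R') (sInv (s R)))
        (sInv⁺ (s L) (↭-sym (s-↭ L)) refl) (∈-map⁺ (λ R' → L ++ m ∷ R') (sInv⁺ (s R) (↭-sym (s-↭ R)) refl)))
    where
      LR<m : All (_< m) (L ++ R)
      LR<m = Perm.All-resp-↭ (↭-sym (Perm.drop-mid L τ σ↭)) (All.++⁺ τ<m [])
      sLsR : s L ++ s R ≡ τ
      sLsR = proj₁ (∷ʳ-injective (s L ++ s R) τ
        (trans (++-assoc (s L) (s R) [ m ])
          (trans (sym (s-max L R (All.++⁻ˡ L LR<m) (All.++⁻ʳ L LR<m))) sσ)))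

  -- Different choices glue to different orderings, since m occurs once.
  unique-glued : ∀ {uv} → uv ∈ cuts τ → Unique (glued m uv)
  unique-glued {u , v} uv∈ =
    unique-concatMap (λ L → map (λ R → L ++ m ∷ R) (sInv v)) (sInv u) (unique-sInv u (proj₁ (cut-unique uv∈)))
      (λ {L} _ → Unique.map⁺ (λ {R} {R'} eq → proj₂ (∷-injective (++-cancelˡ L (m ∷ R) (m ∷ R') eq)))
                             (unique-sInv v (proj₂ (cut-unique uv∈))))
      sameLeft
    where
      sameLeft : ∀ {L L' σ} → L ∈ sInv u → L' ∈ sInv u →
        σ ∈ map (λ R → L ++ m ∷ R) (sInv v) → σ ∈ map (λ R → L' ++ m ∷ R) (sInv v) → L ≡ L'
      sameLeft {L} {L'} L∈ L'∈ σ∈ σ∈' with ∈-map⁻ (λ R → L ++ m ∷ R) σ∈ | ∈-map⁻ (λ R → L' ++ m ∷ R) σ∈'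
      ... | R , _ , refl | R' , _ , eq =
        proj₁ (++-∷-injective L L' (below-∉ (preimage-below u L∈ u<m)) (below-∉ (preimage-below u L'∈ u<m)) eq)
        where u<m = proj₁ (cut-below uv∈)

  unique-gluedAll : Unique (gluedAll τ m)
  unique-gluedAll = unique-concatMap (glued m) (cuts τ) (unique-cuts τ) unique-glued sameCut
    where
      sameCut : ∀ {uv uv' σ} → uv ∈ cuts τ → uv' ∈ cuts τ → σ ∈ glued m uv → σ ∈ glued m uv' → uv ≡ uv'
      sameCut {u , v} {u' , v'} uv∈ uv'∈ σ∈ σ∈' with ∈-glued⁻ {m} {u , v} σ∈ | ∈-glued⁻ {m} {u' , v'} σ∈'
      ... | L , R , L∈ , R∈ , refl | L' , R' , L'∈ , R'∈ , eq
        with ++-∷-injective L L' (below-∉ (preimage-below u L∈ (proj₁ (cut-below uv∈))))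
                                 (below-∉ (preimage-below u' L'∈ (proj₁ (cut-below uv'∈)))) eq
      ...   | refl , refl = cong₂ _,_ (trans (sym (proj₂ (sInv⁻ u L∈))) (proj₂ (sInv⁻ u' L'∈)))
                                      (trans (sym (proj₂ (sInv⁻ v R∈))) (proj₂ (sInv⁻ v' R'∈)))

  sInv-snoc : sInv (τ ++ [ m ]) ↭ gluedAll τ m
  sInv-snoc = unique-↭ (unique-sInv _ (Unique.++⁺ uτ ([] ∷ []) (λ { (m∈τ , here refl) → below-∉ τ<m m∈τ })))
                       unique-gluedAll ⊆gluedAll gluedAll⊆

<?-true : ∀ {a b} → a < b → ⌊ a <? b ⌋ ≡ true
<?-true {a} {b} a<b with a <? b
... | yes _   = refl
... | no  a≮b = ⊥-elim (a≮b a<b)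

<?-false : ∀ {a b} → b < a → ⌊ a <? b ⌋ ≡ false
<?-false {a} {b} b<a with a <? b
... | yes a<b = ⊥-elim (ℕ.<-asym b<a a<b)
... | no  _   = refl

if-same : ∀ (c : Bool) {n : ℕ} → (if c then n else n) ≡ n
if-same true  = refl
if-same false = refl

-- No descent sits just before the maximum, so descents split there.
des-++-max : ∀ {m} L R → All (_< m) L → des (L ++ m ∷ R) ≡ des L + des (m ∷ R)
des-++-max []          R _ = refl
des-++-max {m} (a ∷ []) R (a<m ∷ _) rewrite <?-false {m} {a} a<m = refl
des-++-max (a ∷ b ∷ L) R (_ ∷ L<m) rewrite des-++-max (b ∷ L) R L<m =
  sym (ℕ.+-assoc (if ⌊ b <? a ⌋ then 1 else 0) _ _)

des-max-∷ : ∀ {m r} R → r < m → des (m ∷ r ∷ R) ≡ suc (des (r ∷ R))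
des-max-∷ R r<m rewrite <?-true r<m = refl

-- The number of peaks of m R where m is the maximum, plus one for the
-- peak at m when it has a right neighbour.
peaksAfterMax : List ℕ → ℕ
peaksAfterMax []      = 0
peaksAfterMax (r ∷ R) = suc (peaksℕ (r ∷ R))

-- A maximum in first position is not a peak, nor is its right neighbour.
peaks-max-∷ : ∀ {m} R → All (_< m) R → peaksℕ (m ∷ R) ≡ peaksℕ R
peaks-max-∷ []           _         = refl
peaks-max-∷ (r ∷ [])     _         = refl
peaks-max-∷ {m} (r ∷ r' ∷ R) (r<m ∷ _) rewrite <?-false {m} {r} r<m = refl

-- After a nonempty prefix, the maximum is a peak iff it is not last.
peaks-++-max : ∀ {m} a L R → All (_< m) (a ∷ L) → All (_< m) R →
  peaksℕ (a ∷ L ++ m ∷ R) ≡ peaksℕ (a ∷ L) + peaksAfterMax R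
peaks-++-max a [] [] _ _ = refl
peaks-++-max a [] (r ∷ R) (a<m ∷ _) (r<m ∷ R<m)
  rewrite <?-true a<m | <?-true r<m = cong suc (peaks-max-∷ (r ∷ R) (r<m ∷ R<m))
peaks-++-max {m} a (b ∷ []) R (_ ∷ b<m ∷ _) R<m
  rewrite <?-false {m} {b} b<m | if-same ⌊ a <? b ⌋ {0} = peaks-++-max b [] R (b<m ∷ []) R<m
peaks-++-max a (b ∷ c ∷ L) R (_ ∷ L<m) R<m rewrite peaks-++-max b (c ∷ L) R L<m R<m =
  sym (ℕ.+-assoc (if ⌊ a <? b ⌋ then (if ⌊ c <? b ⌋ then 1 else 0) else 0) _ _)

desExp : List ℕ → ℕ
desExp σ = des σ + 1

peakExp : List ℕ → ℕ
peakExp σ = ∣ peak σ ℤ.+ ℤ.+ 1 ∣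

suc-split : ∀ p q → p + suc q + 1 ≡ (p + 1) + (q + 1)
suc-split p q = trans (ℕ.+-assoc p (suc q) 1) (sym (ℕ.+-assoc p 1 (q + 1)))

desExp-max : ∀ {m} L r R → All (_< m) L → r < m → desExp (L ++ m ∷ r ∷ R) ≡ desExp L + desExp (r ∷ R)
desExp-max L r R L<m r<m rewrite des-++-max L (r ∷ R) L<m | des-max-∷ R r<m = suc-split (des L) (des (r ∷ R))

peakExp-max : ∀ {m} L r R → All (_< m) L → All (_< m) (r ∷ R) →
  peakExp (L ++ m ∷ r ∷ R) ≡ peakExp L + peakExp (r ∷ R)
peakExp-max []      r R _    rR<m = cong (_+ 1) (peaks-max-∷ (r ∷ R) rR<m)
peakExp-max (a ∷ L) r R aL<m rR<m rewrite peaks-++-max a L (r ∷ R) aL<m rR<m =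
  suc-split (peaksℕ (a ∷ L)) (peaksℕ (r ∷ R))

desExp-last : ∀ {m} L → All (_< m) L → desExp (L ++ [ m ]) ≡ desExp L
desExp-last L L<m rewrite des-++-max L [] L<m | ℕ.+-identityʳ (des L) = refl

peakExp-last : ∀ {m} a L → All (_< m) (a ∷ L) → peakExp (a ∷ L ++ [ m ]) ≡ peakExp (a ∷ L)
peakExp-last a L aL<m rewrite peaks-++-max a L [] aL<m [] | ℕ.+-identityʳ (peaksℕ (a ∷ L)) = refl

record Pivot : Set where
  constructor pivot
  field
    left  : List ℕ
    point : ℕ
    right : List ℕ
open Pivot

consLeft : ℕ → Pivot → Pivot
consLeft a t = pivot (a ∷ left t) (point t) (right t)

pivots : List ℕ → List Pivot
pivots []      = []
pivots (a ∷ X) = pivot [] a X ∷ map (consLeft a) (pivots X)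

∈-pivots⁻ : ∀ {t} X → t ∈ pivots X → left t ++ point t ∷ right t ≡ X
∈-pivots⁻ (a ∷ X) (here refl) = refl
∈-pivots⁻ (a ∷ X) (there t∈) with ∈-map⁻ (consLeft a) t∈
... | _ , t∈' , refl = cong (a ∷_) (∈-pivots⁻ X t∈')

map-point-pivots : ∀ X → map point (pivots X) ≡ X
map-point-pivots []      = refl
map-point-pivots (a ∷ X) = cong (a ∷_) (trans (sym (map-∘ (pivots X))) (map-point-pivots X))

module Sums (R : CommutativeSemiring 0ℓ 0ℓ) where
  open CommutativeSemiring R
    using ( Carrier; _≈_; 0#; +-cong; +-congˡ; +-congʳ; +-identityˡ; +-identityʳ; +-assoc; +-comm
          ; *-congˡ; *-identityˡ; *-assoc; zeroˡ; zeroʳ; distribˡ; distribʳ; +-commutativeSemigroup )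
    renaming (_+_ to _⊕_; _*_ to _⊗_; refl to ≈-refl; sym to ≈-sym; trans to ≈-trans; setoid to ≈-setoid)
  open import Relation.Binary.Reasoning.Setoid ≈-setoid
  open Poly R using (sumR; pow)
  open import Algebra.Properties.CommutativeSemigroup +-commutativeSemigroup
    using () renaming (interchange to +-interchange)

  ∑ : {A : Set} → (A → Carrier) → List A → Carrier
  ∑ f xs = sumR (map f xs)

  module _ {A : Set} where

    ∑-++ : ∀ (f : A → Carrier) xs ys → ∑ f (xs ++ ys) ≈ ∑ f xs ⊕ ∑ f ys
    ∑-++ f []       ys = ≈-sym (+-identityˡ _)
    ∑-++ f (a ∷ xs) ys = ≈-trans (+-congˡ (∑-++ f xs ys)) (≈-sym (+-assoc _ _ _))

    ∑-cong : ∀ {f g : A → Carrier} xs → (∀ {z} → z ∈ xs → f z ≈ g z) → ∑ f xs ≈ ∑ g xs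
    ∑-cong []       _  = ≈-refl
    ∑-cong (a ∷ xs) eq = +-cong (eq (here refl)) (∑-cong xs (λ z∈ → eq (there z∈)))

    ∑-zero : ∀ (f : A → Carrier) xs → (∀ {z} → z ∈ xs → f z ≈ 0#) → ∑ f xs ≈ 0#
    ∑-zero f []       _    = ≈-refl
    ∑-zero f (a ∷ xs) vanish = ≈-trans (+-cong (vanish (here refl)) (∑-zero f xs (λ z∈ → vanish (there z∈))))
                                     (+-identityˡ 0#)

    ∑-↭ : ∀ (f : A → Carrier) {xs ys} → xs ↭ ys → ∑ f xs ≈ ∑ f ys
    ∑-↭ f p = foldr-↭ (Perm.map⁺ f p)
      where
        foldr-↭ : ∀ {cs ds} → cs ↭ ds → sumR cs ≈ sumR ds
        foldr-↭ _↭_.refl          = ≈-refl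
        foldr-↭ (_↭_.prep c q)    = +-congˡ (foldr-↭ q)
        foldr-↭ (_↭_.swap c d q)  = ≈-trans (≈-sym (+-assoc c d _))
          (≈-trans (+-congʳ (+-comm c d)) (≈-trans (+-assoc d c _) (+-congˡ (+-congˡ (foldr-↭ q)))))
        foldr-↭ (_↭_.trans q q')  = ≈-trans (foldr-↭ q) (foldr-↭ q')

    *-∑ : ∀ c (f : A → Carrier) xs → c ⊗ ∑ f xs ≈ ∑ (λ z → c ⊗ f z) xs
    *-∑ c f []       = zeroʳ c
    *-∑ c f (a ∷ xs) = ≈-trans (distribˡ c _ _) (+-congˡ (*-∑ c f xs))

    ∑-* : ∀ c (f : A → Carrier) xs → ∑ f xs ⊗ c ≈ ∑ (λ z → f z ⊗ c) xs
    ∑-* c f []       = zeroˡ c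
    ∑-* c f (a ∷ xs) = ≈-trans (distribʳ c _ _) (+-congˡ (∑-* c f xs))

    ∑-+ : ∀ (f g : A → Carrier) xs → ∑ (λ z → f z ⊕ g z) xs ≈ ∑ f xs ⊕ ∑ g xs
    ∑-+ f g []       = ≈-sym (+-identityˡ 0#)
    ∑-+ f g (a ∷ xs) = ≈-trans (+-congˡ (∑-+ f g xs)) (+-interchange _ _ _ _)

  ∑-map : ∀ {A B : Set} (f : B → Carrier) (g : A → B) xs → ∑ f (map g xs) ≈ ∑ (λ a → f (g a)) xs
  ∑-map f g []       = ≈-refl
  ∑-map f g (a ∷ xs) = +-congˡ (∑-map f g xs)

  ∑-concatMap : ∀ {A B : Set} (f : B → Carrier) (g : A → List B) xs →
    ∑ f (concatMap g xs) ≈ ∑ (λ a → ∑ f (g a)) xs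
  ∑-concatMap f g []       = ≈-refl
  ∑-concatMap f g (a ∷ xs) = ≈-trans (∑-++ f (g a) (concatMap g xs)) (+-congˡ (∑-concatMap f g xs))

  ∑-swap : ∀ {A B : Set} (f : A → B → Carrier) xs ys →
    ∑ (λ a → ∑ (f a) ys) xs ≈ ∑ (λ b → ∑ (λ a → f a b) xs) ys
  ∑-swap f []       ys = ≈-sym (∑-zero (λ _ → 0#) ys (λ _ → ≈-refl))
  ∑-swap f (a ∷ xs) ys = ≈-trans (+-congˡ (∑-swap f xs ys)) (≈-sym (∑-+ (f a) _ ys))

  pow-+ : ∀ a m n → pow a (m + n) ≈ pow a m ⊗ pow a n
  pow-+ a zero    n = ≈-sym (*-identityˡ _)
  pow-+ a (suc m) n = ≈-trans (*-congˡ (pow-+ a m n)) (≈-sym (*-assoc a _ _))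

  -- A cut of A ++ C falls strictly inside A or inside C.
  ∑-cuts-++ : ∀ (h : List ℕ × List ℕ → Carrier) A C →
    ∑ h (cuts (A ++ C)) ≈ ∑ (λ t → h (left t , point t ∷ right t ++ C)) (pivots A)
                        ⊕ ∑ (λ ab → h (A ++ proj₁ ab , proj₂ ab)) (cuts C)
  ∑-cuts-++ h []      C = ≈-sym (+-identityˡ _)
  ∑-cuts-++ h (a ∷ A) C = begin
    h₀ ⊕ ∑ h (map (map₁ (a ∷_)) (cuts (A ++ C)))      ≈⟨ +-congˡ (∑-map h (map₁ (a ∷_)) (cuts (A ++ C))) ⟩
    h₀ ⊕ ∑ (λ uv → h (map₁ (a ∷_) uv)) (cuts (A ++ C)) ≈⟨ +-congˡ (∑-cuts-++ (λ uv → h (map₁ (a ∷_) uv)) A C) ⟩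
    h₀ ⊕ (inA ⊕ inC)                                  ≈⟨ ≈-sym (+-assoc _ _ _) ⟩
    (h₀ ⊕ inA) ⊕ inC                                  ≈⟨ +-congʳ (+-congˡ (≈-sym (∑-map _ (consLeft a) (pivots A)))) ⟩
    (h₀ ⊕ ∑ (λ t → h (left t , point t ∷ right t ++ C)) (map (consLeft a) (pivots A))) ⊕ inC ∎
    where
      h₀  = h ([] , a ∷ A ++ C)
      inA = ∑ (λ t → h (a ∷ left t , point t ∷ right t ++ C)) (pivots A)
      inC = ∑ (λ ab → h (a ∷ A ++ proj₁ ab , proj₂ ab)) (cuts C)

  ∑-pivots-snoc : ∀ (g : Pivot → Carrier) X m →
    ∑ g (pivots (X ++ [ m ])) ≈ ∑ (λ t → g (pivot (left t) (point t) (right t ++ [ m ]))) (pivots X) ⊕ g (pivot X m [])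
  ∑-pivots-snoc g []      m = ≈-trans (+-identityʳ _) (≈-sym (+-identityˡ _))
  ∑-pivots-snoc g (a ∷ X) m = begin
    g₀ ⊕ ∑ g (map (consLeft a) (pivots (X ++ [ m ])))       ≈⟨ +-congˡ (∑-map g (consLeft a) (pivots (X ++ [ m ]))) ⟩
    g₀ ⊕ ∑ (λ t → g (consLeft a t)) (pivots (X ++ [ m ]))  ≈⟨ +-congˡ (∑-pivots-snoc (λ t → g (consLeft a t)) X m) ⟩
    g₀ ⊕ (inner ⊕ g (pivot (a ∷ X) m []))                   ≈⟨ ≈-sym (+-assoc _ _ _) ⟩
    (g₀ ⊕ inner) ⊕ g (pivot (a ∷ X) m [])                   ≈⟨ +-congʳ (+-congˡ (≈-sym (∑-map _ (consLeft a) (pivots X)))) ⟩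
    (g₀ ⊕ ∑ extend (map (consLeft a) (pivots X))) ⊕ g (pivot (a ∷ X) m []) ∎
    where
      g₀ = g (pivot [] a (X ++ [ m ]))
      extend : Pivot → Carrier
      extend t = g (pivot (left t) (point t) (right t ++ [ m ]))
      inner = ∑ (λ t → extend (consLeft a t)) (pivots X)

  -- Choosing a pivot of X and then cutting after it is the same as
  -- cutting X and then choosing a pivot before the cut.
  ∑-pivots-cuts : ∀ (G : List ℕ → ℕ → List ℕ → List ℕ → Carrier) X →
    ∑ (λ t → ∑ (λ ab → G (left t) (point t) (proj₁ ab) (proj₂ ab)) (cuts (right t))) (pivots X)
    ≈ ∑ (λ ab → ∑ (λ t → G (left t) (point t) (right t) (proj₂ ab)) (pivots (proj₁ ab))) (cuts X)
  ∑-pivots-cuts G []      = ≈-sym (+-identityˡ _)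
  ∑-pivots-cuts G (a ∷ X) = begin
    first ⊕ ∑ H (map (consLeft a) (pivots X))   ≈⟨ +-congˡ (∑-map H (consLeft a) (pivots X)) ⟩
    first ⊕ ∑ (λ t → H (consLeft a t)) (pivots X) ≈⟨ +-congˡ (∑-pivots-cuts (λ u → G (a ∷ u)) X) ⟩
    first ⊕ ∑ K' (cuts X)                       ≈⟨ ≈-sym (∑-+ _ K' (cuts X)) ⟩
    ∑ (λ ab → G [] a (proj₁ ab) (proj₂ ab) ⊕ K' ab) (cuts X)
      ≈⟨ ∑-cong (cuts X) (λ {ab} _ → +-congˡ (≈-sym (∑-map (λ t → G (left t) (point t) (right t) (proj₂ ab))
                                                             (consLeft a) (pivots (proj₁ ab))))) ⟩
    ∑ (λ ab → K (map₁ (a ∷_) ab)) (cuts X)       ≈⟨ ≈-sym (∑-map K (map₁ (a ∷_)) (cuts X)) ⟩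
    ∑ K (map (map₁ (a ∷_)) (cuts X))             ≈⟨ ≈-sym (+-identityˡ _) ⟩
    0# ⊕ ∑ K (map (map₁ (a ∷_)) (cuts X))        ∎
    where
      first = ∑ (λ ab → G [] a (proj₁ ab) (proj₂ ab)) (cuts X)
      H : Pivot → Carrier
      H t = ∑ (λ ab → G (left t) (point t) (proj₁ ab) (proj₂ ab)) (cuts (right t))
      K : List ℕ × List ℕ → Carrier
      K ab = ∑ (λ t → G (left t) (point t) (right t) (proj₂ ab)) (pivots (proj₁ ab))
      K' : List ℕ × List ℕ → Carrier
      K' ab = ∑ (λ t → G (a ∷ left t) (point t) (right t) (proj₂ ab)) (pivots (proj₁ ab))

module GeneratingFunction (R : CommutativeSemiring 0ℓ 0ℓ) (x y : CommutativeSemiring.Carrier R) where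
  open CommutativeSemiring R
    using (Carrier; _≈_; 0#; 1#; reflexive; +-identityʳ; *-cong; *-identityʳ; *-commutativeSemigroup)
    renaming (_+_ to _⊕_; _*_ to _⊗_; sym to ≈-sym; trans to ≈-trans; setoid to ≈-setoid)
  open import Algebra.Properties.CommutativeSemigroup *-commutativeSemigroup
    using () renaming (interchange to *-interchange)
  open import Relation.Binary.Reasoning.Setoid ≈-setoid
  open Poly R using (pow)
  open Sums R

  wt : List ℕ → Carrier
  wt σ = pow x (desExp σ) ⊗ pow y (peakExp σ)

  F : List ℕ → Carrier
  F τ = Poly.F R x y τ

  -- F with the empty permutation weighted 1 instead of x.
  F₁ : List ℕ → Carrier
  F₁ []      = 1#
  F₁ (a ∷ l) = F (a ∷ l)

  wt-max : ∀ {m} L r R → All (_< m) L → All (_< m) (r ∷ R) → wt (L ++ m ∷ r ∷ R) ≈ wt L ⊗ wt (r ∷ R)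
  wt-max L r R L<m rR<m = begin
    pow x (desExp (L ++ _ ∷ r ∷ R)) ⊗ pow y (peakExp (L ++ _ ∷ r ∷ R))
      ≡⟨ cong₂ (λ i j → pow x i ⊗ pow y j) (desExp-max L r R L<m (All.head rR<m)) (peakExp-max L r R L<m rR<m) ⟩
    pow x (desExp L + desExp (r ∷ R)) ⊗ pow y (peakExp L + peakExp (r ∷ R))
      ≈⟨ *-cong (pow-+ x (desExp L) _) (pow-+ y (peakExp L) _) ⟩
    (pow x (desExp L) ⊗ pow x (desExp (r ∷ R))) ⊗ (pow y (peakExp L) ⊗ pow y (peakExp (r ∷ R)))
      ≈⟨ *-interchange _ _ _ _ ⟩
    wt L ⊗ wt (r ∷ R) ∎

  wt-last : ∀ {m} a L → All (_< m) (a ∷ L) → wt (a ∷ L ++ [ m ]) ≈ wt (a ∷ L)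
  wt-last a L aL<m = reflexive (cong₂ (λ i j → pow x i ⊗ pow y j) (desExp-last (a ∷ L) aL<m) (peakExp-last a L aL<m))

  module _ (τ : List ℕ) (m : ℕ) (uτ : Unique τ) (τ<m : All (_< m) τ) where
    open PreimagesAtMaximum τ m uτ τ<m

    glued-inner : ∀ {u r v} → (u , r ∷ v) ∈ cuts τ → ∑ wt (glued m (u , r ∷ v)) ≈ F u ⊗ F (r ∷ v)
    glued-inner {u} {r} {v} uv∈ = begin
      ∑ wt (glued m (u , r ∷ v))
        ≈⟨ ∑-concatMap wt _ (sInv u) ⟩
      ∑ (λ L → ∑ wt (map (λ R → L ++ m ∷ R) (sInv (r ∷ v)))) (sInv u)
        ≈⟨ ∑-cong (sInv u) (λ L∈ → ≈-trans (∑-map wt _ (sInv (r ∷ v))) (∑-cong (sInv (r ∷ v)) (split L∈))) ⟩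
      ∑ (λ L → ∑ (λ R → wt L ⊗ wt R) (sInv (r ∷ v))) (sInv u)
        ≈⟨ ∑-cong (sInv u) (λ {L} _ → ≈-sym (*-∑ (wt L) wt (sInv (r ∷ v)))) ⟩
      ∑ (λ L → wt L ⊗ F (r ∷ v)) (sInv u)
        ≈⟨ ≈-sym (∑-* (F (r ∷ v)) wt (sInv u)) ⟩
      F u ⊗ F (r ∷ v) ∎
      where
        split : ∀ {L R} → L ∈ sInv u → R ∈ sInv (r ∷ v) → wt (L ++ m ∷ R) ≈ wt L ⊗ wt R
        split {L} {[]}     _  R∈ with () ← proj₂ (sInv⁻ (r ∷ v) R∈)
        split {L} {r' ∷ R} L∈ R∈ =
          wt-max L r' R (preimage-below u L∈ (proj₁ (cut-below uv∈)))
                        (preimage-below (r ∷ v) R∈ (proj₂ (cut-below uv∈)))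

    glued-end : ∀ {u} → τ ≢ [] → (u , []) ∈ cuts τ → ∑ wt (glued m (u , [])) ≈ F u ⊗ 1#
    glued-end {u} τ≢[] uv∈ = begin
      ∑ wt (glued m (u , []))                 ≈⟨ ∑-concatMap wt _ (sInv u) ⟩
      ∑ (λ L → wt (L ++ [ m ]) ⊕ 0#) (sInv u) ≈⟨ ∑-cong (sInv u) lastTerm ⟩
      ∑ wt (sInv u)                           ≈⟨ ≈-sym (*-identityʳ _) ⟩
      F u ⊗ 1#                                ∎
      where
        lastTerm : ∀ {L} → L ∈ sInv u → wt (L ++ [ m ]) ⊕ 0# ≈ wt L
        lastTerm {[]} L∈ = ⊥-elim (τ≢[] (trans (sym (∈-cuts⁻ τ uv∈))
                                       (trans (++-identityʳ u) (sym (proj₂ (sInv⁻ u L∈))))))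
        lastTerm {a ∷ L} L∈ = ≈-trans (+-identityʳ _) (wt-last a L (preimage-below u L∈ (proj₁ (cut-below uv∈))))

  F-snoc-max : ∀ τ m → τ ≢ [] → Unique τ → All (_< m) τ →
    F (τ ++ [ m ]) ≈ ∑ (λ uv → F (proj₁ uv) ⊗ F₁ (proj₂ uv)) (cuts τ)
  F-snoc-max τ m τ≢[] uτ τ<m = begin
    ∑ wt (sInv (τ ++ [ m ]))                         ≈⟨ ∑-↭ wt (PreimagesAtMaximum.sInv-snoc τ m uτ τ<m) ⟩
    ∑ wt (gluedAll τ m)                              ≈⟨ ∑-concatMap wt (glued m) (cuts τ) ⟩
    ∑ (λ uv → ∑ wt (glued m uv)) (cuts τ)            ≈⟨ ∑-cong (cuts τ) perCut ⟩
    ∑ (λ uv → F (proj₁ uv) ⊗ F₁ (proj₂ uv)) (cuts τ) ∎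
    where
      perCut : ∀ {uv} → uv ∈ cuts τ → ∑ wt (glued m uv) ≈ F (proj₁ uv) ⊗ F₁ (proj₂ uv)
      perCut {u , []}    = glued-end τ m uτ τ<m τ≢[]
      perCut {u , r ∷ v} = glued-inner τ m uτ τ<m

  F-vanish : ∀ {τ τ' a b} → Unique τ → τ ≡ τ' ++ [ a ] → b ∈ τ → a < b → F τ ≈ 0#
  F-vanish {τ} {τ'} {a} {b} uτ τ≡ b∈ a<b = ∑-zero wt (sInv τ) noPreimage
    where
      noPreimage : ∀ {σ} → σ ∈ sInv τ → wt σ ≈ 0#
      noPreimage σ∈ with sInv⁻ τ σ∈
      ... | σ↭ , sσ = ⊥-elim (ℕ.<⇒≱ a<b (All.lookup σ≤a (Perm.∈-resp-↭ (↭-sym σ↭) b∈)))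
        where σ≤a = s-last-max (unique-resp-↭ (↭-sym σ↭) uτ) (trans sσ τ≡)

suffix-∷ʳ : ∀ {A : Set} (u : List A) v {Q p} → u ++ v ≡ Q ++ [ p ] → v ≢ [] → ∃[ Q' ] v ≡ Q' ++ [ p ]
suffix-∷ʳ u v eq v≢[] with initLast v
... | []       = ⊥-elim (v≢[] refl)
... | v' ∷ʳ′ a = v' , cong (λ b → v' ++ [ b ]) (proj₂ (∷ʳ-injective (u ++ v') _ (trans (++-assoc u v' [ a ]) eq)))

AllPairs-∷ʳ : ∀ {A : Set} {R : A → A → Set} u {m} → AllPairs R (u ++ [ m ]) → All (λ z → R z m) u
AllPairs-∷ʳ []      _       = []
AllPairs-∷ʳ (a ∷ u) (h ∷ p) = All.lookup h (∈-++⁺ʳ u (here refl)) ∷ AllPairs-∷ʳ u p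

increasing-unique : ∀ {X} → AllPairs _<_ X → Unique X
increasing-unique = AllPairs.map ℕ.<⇒≢

-- The proof of the factorisation replaces P by its nonempty
-- suffixes and X by its prefixes; "admissible" records what survives.
module Shape (p b₀ : ℕ) (B₁ : List ℕ) where

  B : List ℕ
  B = b₀ ∷ B₁

  record Admissible (P X : List ℕ) : Set where
    field
      ends-with-p : ∃[ Q ] P ≡ Q ++ [ p ]
      distinct    : Unique (P ++ B)
      increasing  : AllPairs _<_ X
      above       : ∀ {e z} → e ∈ P ++ B → z ∈ X → e < z

  module _ {P X : List ℕ} (adm : Admissible P X) where
    open Admissible adm

    p∈P : p ∈ P
    p∈P = subst (p ∈_) (sym (proj₂ ends-with-p)) (∈-++⁺ʳ (proj₁ ends-with-p) (here refl))

    P≢[] : ∀ {W} → P ++ W ≢ []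
    P≢[] eq with () ← subst (p ∈_) eq (∈-++⁺ˡ p∈P)

    prefix : ∀ Y {Z} → X ≡ Y ++ Z → Admissible P Y
    prefix Y X≡ = record
      { ends-with-p = ends-with-p ; distinct = distinct
      ; increasing = AllPairs-++ˡ Y (subst (AllPairs _<_) X≡ increasing)
      ; above = λ e∈ z∈ → above e∈ (subst (_ ∈_) (sym X≡) (∈-++⁺ˡ z∈)) }

    suffix : ∀ {t} → t ∈ pivots P → Admissible (point t ∷ right t) X
    suffix {t} t∈ = record
      { ends-with-p = suffix-∷ʳ (left t) (point t ∷ right t) (trans P≡ (proj₂ ends-with-p)) (λ ())
      ; distinct = AllPairs-++ʳ (left t) (subst Unique (trans (cong (_++ B) (sym P≡)) (++-assoc (left t) _ B)) distinct)
      ; increasing = increasing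
      ; above = λ e∈ z∈ → above (inP e∈) z∈ }
      where
        P≡ = ∈-pivots⁻ P t∈
        inP : ∀ {e} → e ∈ (point t ∷ right t) ++ B → e ∈ P ++ B
        inP e∈ = subst (λ l → _ ∈ l ++ B) P≡
                   (subst (_ ∈_) (sym (++-assoc (left t) (point t ∷ right t) B)) (∈-++⁺ʳ (left t) e∈))

  module AtMaximum {P X' m} (adm : Admissible P (X' ++ [ m ])) where
    open Admissible adm

    X'-increasing : AllPairs _<_ X'
    X'-increasing = AllPairs-++ˡ X' increasing

    ready : ∀ A W → Unique A → (∀ {e} → e ∈ A → e ∈ P ++ B) → AllPairs _<_ W → (∀ {z} → z ∈ W → z ∈ X') →
      Unique (A ++ W) × All (_< m) (A ++ W)
    ready A W uA A⊆ W↑ W⊆ =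
      Unique.++⁺ uA (increasing-unique W↑) (λ { (e∈A , e∈W) → ℕ.<-irrefl refl (above (A⊆ e∈A) (∈-++⁺ˡ (W⊆ e∈W))) }) ,
      All.++⁺ (All.tabulate (λ e∈ → above (A⊆ e∈) (∈-++⁺ʳ X' (here refl))))
              (All.tabulate (λ z∈ → All.lookup (AllPairs-∷ʳ X' increasing) (W⊆ z∈)))

module Factorisation (R : CommutativeSemiring 0ℓ 0ℓ) (x y : CommutativeSemiring.Carrier R)
                     (p b₀ : ℕ) (B₁ : List ℕ) (B<p : All (_< p) (b₀ ∷ B₁)) where
  open CommutativeSemiring R
    using ( Carrier; _≈_; 0#; reflexive; +-cong; +-congˡ; +-congʳ; +-identityʳ; *-congˡ; *-congʳ; *-assoc
          ; zeroˡ; distribʳ; +-commutativeSemigroup; *-commutativeSemigroup )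
    renaming (_+_ to _⊕_; _*_ to _⊗_; sym to ≈-sym; trans to ≈-trans; setoid to ≈-setoid)
  open import Algebra.Properties.CommutativeSemigroup +-commutativeSemigroup using () renaming (x∙yz≈xz∙y to +-rotate)
  open import Algebra.Properties.CommutativeSemigroup *-commutativeSemigroup using () renaming (xy∙z≈xz∙y to *-swapʳ)
  open import Relation.Binary.Reasoning.Setoid ≈-setoid
  open Sums R
  open GeneratingFunction R x y
  open Shape p b₀ B₁

  S : List ℕ → List ℕ → Carrier
  S P X = ∑ (λ t → F (P ++ right t) ⊗ F (B ++ left t)) (pivots X)

  -- A nonempty prefix u of B contributes nothing: P u ends below p ∈ P.
  prefix-vanish : ∀ {P X} → Admissible P X → ∀ u v → u ++ v ≡ B → u ≢ [] → F (P ++ u) ≈ 0#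
  prefix-vanish {P} adm u v uv≡B u≢[] with initLast u
  ... | []       = ⊥-elim (u≢[] refl)
  ... | u' ∷ʳ′ a = F-vanish distinct-Pu (sym (++-assoc P u' [ a ])) (∈-++⁺ˡ (p∈P adm)) (All.lookup B<p a∈B)
    where
      PB≡ : P ++ B ≡ (P ++ u' ++ [ a ]) ++ v
      PB≡ = trans (cong (P ++_) (sym uv≡B)) (sym (++-assoc P (u' ++ [ a ]) v))
      distinct-Pu : Unique (P ++ u' ++ [ a ])
      distinct-Pu = AllPairs-++ˡ (P ++ u' ++ [ a ]) (subst Unique PB≡ (Admissible.distinct adm))
      a∈B : a ∈ B
      a∈B = subst (a ∈_) uv≡B (∈-++⁺ˡ (∈-++⁺ʳ u' (here refl)))

  base : ∀ {P} → Admissible P [] → F (P ++ B ++ []) ≈ 0#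
  base {P} adm = ≈-trans (reflexive (cong (λ l → F (P ++ l)) (++-identityʳ B)))
                         (prefix-vanish adm B [] (++-identityʳ B) (λ ()))

  module Step (P X' : List ℕ) (m : ℕ) (adm : Admissible P (X' ++ [ m ]))
              (IH : ∀ P' Y → length Y ≤ length X' → Admissible P' Y → F (P' ++ B ++ Y) ≈ S P' Y) where
    open Admissible adm
    open AtMaximum adm

    h : List ℕ × List ℕ → Carrier
    h uv = F (proj₁ uv) ⊗ F₁ (proj₂ uv)

    inP inB inX : Carrier
    inP = ∑ (λ t → F (left t) ⊗ S (point t ∷ right t) X') (pivots P)
    inB = F (P ++ []) ⊗ F (B ++ X')
    inX = ∑ (λ ab → S P (proj₁ ab) ⊗ F₁ (proj₂ ab)) (cuts X')

    -- On the left, the terms of the recursion at m for cuts of P B X' inside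
    -- P, inside B, and inside X'.
    cutP cutB cutX : Carrier
    cutP = ∑ (λ t → h (left t , point t ∷ right t ++ B ++ X')) (pivots P)
    cutB = ∑ (λ t → h (P ++ left t , point t ∷ right t ++ X')) (pivots B)
    cutX = ∑ (λ ab → h (P ++ B ++ proj₁ ab , proj₂ ab)) (cuts X')

    cutInsideP : cutP ≈ inP
    cutInsideP = ∑-cong (pivots P) (λ t∈ → *-congˡ (IH _ X' ℕ.≤-refl (suffix (prefix adm X' refl) t∈)))

    -- Of the cuts inside B only the one before b₀ survives.
    cutInsideB : cutB ≈ inB
    cutInsideB = begin
      inB ⊕ ∑ (λ t → h (P ++ left t , point t ∷ right t ++ X')) (map (consLeft b₀) (pivots B₁))
        ≈⟨ +-congˡ (∑-map _ (consLeft b₀) (pivots B₁)) ⟩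
      inB ⊕ ∑ (λ t → h (P ++ b₀ ∷ left t , point t ∷ right t ++ X')) (pivots B₁)
        ≈⟨ +-congˡ (∑-zero _ (pivots B₁) (λ t∈ → ≈-trans (*-congʳ (vanish t∈)) (zeroˡ _))) ⟩
      inB ⊕ 0# ≈⟨ +-identityʳ inB ⟩
      inB ∎
      where
        vanish : ∀ {t} → t ∈ pivots B₁ → F (P ++ b₀ ∷ left t) ≈ 0#
        vanish t∈ = prefix-vanish adm (b₀ ∷ _) _ (cong (b₀ ∷_) (∈-pivots⁻ B₁ t∈)) (λ ())

    cutInsideX : cutX ≈ inX
    cutInsideX = ∑-cong (cuts X') (λ {ab} ab∈ → *-congʳ (IH P (proj₁ ab) (shorter ab∈) (prefix adm _ (X≡ ab∈))))
      where
        X≡ : ∀ {ab} → ab ∈ cuts X' → X' ++ [ m ] ≡ proj₁ ab ++ proj₂ ab ++ [ m ]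
        X≡ {ab} ab∈ = trans (cong (_++ [ m ]) (sym (∈-cuts⁻ X' ab∈))) (++-assoc (proj₁ ab) _ [ m ])
        shorter : ∀ {ab} → ab ∈ cuts X' → length (proj₁ ab) ≤ length X'
        shorter {ab} ab∈ = subst (λ l → length (proj₁ ab) ≤ length l) (∈-cuts⁻ X' ab∈)
          (subst (length (proj₁ ab) ≤_) (sym (length-++ (proj₁ ab))) (ℕ.m≤m+n _ _))

    lhs : F (P ++ B ++ X' ++ [ m ]) ≈ inP ⊕ (inB ⊕ inX)
    lhs = begin
      F (P ++ B ++ X' ++ [ m ])
        ≡⟨ cong F (trans (cong (P ++_) (sym (++-assoc B X' [ m ]))) (sym (++-assoc P (B ++ X') [ m ]))) ⟩
      F ((P ++ B ++ X') ++ [ m ])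
        ≈⟨ F-snoc-max (P ++ B ++ X') m (P≢[] adm) (subst Unique (++-assoc P B X') (proj₁ ready-PBX'))
                      (subst (All (_< m)) (++-assoc P B X') (proj₂ ready-PBX')) ⟩
      ∑ h (cuts (P ++ B ++ X'))                                         ≈⟨ ∑-cuts-++ h P (B ++ X') ⟩
      cutP ⊕ ∑ (λ ab → h (P ++ proj₁ ab , proj₂ ab)) (cuts (B ++ X'))  ≈⟨ +-congˡ (∑-cuts-++ _ B X') ⟩
      cutP ⊕ (cutB ⊕ cutX)   ≈⟨ +-cong cutInsideP (+-cong cutInsideB cutInsideX) ⟩
      inP ⊕ (inB ⊕ inX)      ∎
      where ready-PBX' = ready (P ++ B) X' distinct (λ e∈ → e∈) X'-increasing (λ z∈ → z∈)

    -- On the right, a pivot j of X' leaves F(P w m) F(B u); cutting P w at m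
    -- splits it into terms with the cut inside P and inside w.
    viaP viaX : Pivot → Carrier
    viaP t = ∑ (λ t₁ → (F (left t₁) ⊗ F (point t₁ ∷ right t₁ ++ right t)) ⊗ F (B ++ left t)) (pivots P)
    viaX t = ∑ (λ ab → (F (P ++ proj₁ ab) ⊗ F (B ++ left t)) ⊗ F₁ (proj₂ ab)) (cuts (right t))

    pivotBeforeMax : ∀ {t} → t ∈ pivots X' → F (P ++ right t ++ [ m ]) ⊗ F (B ++ left t) ≈ viaP t ⊕ viaX t
    pivotBeforeMax {t} t∈ = begin
      F (P ++ right t ++ [ m ]) ⊗ c           ≡⟨ cong (λ l → F l ⊗ c) (sym (++-assoc P (right t) [ m ])) ⟩
      F ((P ++ right t) ++ [ m ]) ⊗ c
        ≈⟨ *-congʳ (F-snoc-max (P ++ right t) m (P≢[] adm) (proj₁ ready-Pw) (proj₂ ready-Pw)) ⟩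
      ∑ h (cuts (P ++ right t)) ⊗ c           ≈⟨ *-congʳ (∑-cuts-++ h P (right t)) ⟩
      (insideP ⊕ insideW) ⊗ c                 ≈⟨ distribʳ c insideP insideW ⟩
      insideP ⊗ c ⊕ insideW ⊗ c               ≈⟨ +-cong (∑-* c _ (pivots P)) (≈-trans (∑-* c _ (cuts (right t))) swapped) ⟩
      viaP t ⊕ viaX t                         ∎
      where
        c = F (B ++ left t)
        insideP = ∑ (λ t₁ → h (left t₁ , point t₁ ∷ right t₁ ++ right t)) (pivots P)
        insideW = ∑ (λ ab → h (P ++ proj₁ ab , proj₂ ab)) (cuts (right t))
        swapped = ∑-cong (cuts (right t)) (λ _ → *-swapʳ _ _ _)
        X'≡ = ∈-pivots⁻ X' t∈
        ready-Pw = ready P (right t) (AllPairs-++ˡ P distinct) ∈-++⁺ˡ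
          (AllPairs.tail (AllPairs-++ʳ (left t) (subst (AllPairs _<_) (sym X'≡) X'-increasing)))
          (λ z∈ → subst (_ ∈_) X'≡ (∈-++⁺ʳ (left t) (there z∈)))

    sum-viaP : ∑ viaP (pivots X') ≈ inP
    sum-viaP = ≈-trans (∑-swap (λ t t₁ → (F (left t₁) ⊗ F (point t₁ ∷ right t₁ ++ right t)) ⊗ F (B ++ left t))
                               (pivots X') (pivots P))
      (∑-cong (pivots P) (λ {t₁} _ → ≈-trans (∑-cong (pivots X') (λ _ → *-assoc _ _ _))
                                             (≈-sym (*-∑ (F (left t₁)) _ (pivots X')))))

    sum-viaX : ∑ viaX (pivots X') ≈ inX
    sum-viaX = ≈-trans (∑-pivots-cuts (λ u j a b → (F (P ++ a) ⊗ F (B ++ u)) ⊗ F₁ b) X')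
      (∑-cong (cuts X') (λ {ab} _ → ≈-sym (∑-* (F₁ (proj₂ ab)) _ (pivots (proj₁ ab)))))

    rhs : S P (X' ++ [ m ]) ≈ (inP ⊕ inX) ⊕ inB
    rhs = begin
      S P (X' ++ [ m ])
        ≈⟨ ∑-pivots-snoc (λ t → F (P ++ right t) ⊗ F (B ++ left t)) X' m ⟩
      ∑ (λ t → F (P ++ right t ++ [ m ]) ⊗ F (B ++ left t)) (pivots X') ⊕ inB
        ≈⟨ +-congʳ (∑-cong (pivots X') pivotBeforeMax) ⟩
      ∑ (λ t → viaP t ⊕ viaX t) (pivots X') ⊕ inB
        ≈⟨ +-congʳ (≈-trans (∑-+ viaP viaX (pivots X')) (+-cong sum-viaP sum-viaX)) ⟩
      (inP ⊕ inX) ⊕ inB ∎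

    step : F (P ++ B ++ X' ++ [ m ]) ≈ S P (X' ++ [ m ])
    step = ≈-trans lhs (≈-trans (+-rotate inP inB inX) (≈-sym rhs))

  factorise : ∀ n P X → length X ≤ n → Admissible P X → F (P ++ B ++ X) ≈ S P X
  factorise n P X len adm with initLast X
  ... | []       = base adm
  ... | X' ∷ʳ′ m with n | subst (_≤ n) (trans (length-++ X') (ℕ.+-comm (length X') 1)) len
  ...   | suc n | s≤s len' = Step.step P X' m adm (λ P' Y lenY → factorise n P' Y (ℕ.≤-trans lenY len'))

at-++ʳ : ∀ A C k → at (A ++ C) (length A + suc k) ≡ at C (suc k)
at-++ʳ []          C k = refl
at-++ʳ (a ∷ [])    C k = refl
at-++ʳ (a ∷ b ∷ A) C k = at-++ʳ (b ∷ A) C k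

at-++ˡ : ∀ A C k → k < length A → at (A ++ C) (suc k) ≡ at A (suc k)
at-++ˡ (a ∷ A) C zero    _         = refl
at-++ˡ (a ∷ A) C (suc k) (s≤s k<) = at-++ˡ A C k k<

at-∈ : ∀ l k → k < length l → at l (suc k) ∈ l
at-∈ (a ∷ l) zero    _        = here refl
at-∈ (a ∷ l) (suc k) (s≤s k<) = there (at-∈ l k k<)

∈⇒at : ∀ {e} l → e ∈ l → ∃[ k ] (k < length l × at l (suc k) ≡ e)
∈⇒at (a ∷ l) (here refl) = 0 , s≤s z≤n , refl
∈⇒at (a ∷ l) (there e∈) with ∈⇒at l e∈
... | k , k< , eq = suc k , s≤s k< , eq

take-at : ∀ k (l : List ℕ) → k < length l → take (suc k) l ≡ take k l ++ [ at l (suc k) ]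
take-at zero    (a ∷ l) _        = refl
take-at (suc k) (a ∷ l) (s≤s k<) = cong (a ∷_) (take-at k l k<)

drop-at : ∀ (l : List ℕ) k → k < length l → drop k l ≡ at l (suc k) ∷ drop (suc k) l
drop-at (a ∷ l) zero    _        = refl
drop-at (a ∷ l) (suc k) (s≤s k<) = drop-at l k k<

take-length-++ : ∀ (A C : List ℕ) → take (length A) (A ++ C) ≡ A
take-length-++ []      C = refl
take-length-++ (a ∷ A) C = cong (a ∷_) (take-length-++ A C)

drop-length-++ : ∀ (A C : List ℕ) → drop (length A) (A ++ C) ≡ C
drop-length-++ []      C = refl
drop-length-++ (a ∷ A) C = drop-length-++ A C

drop-past : ∀ (A : List ℕ) {j C} → drop (suc (length A)) (A ++ j ∷ C) ≡ C
drop-past []      = refl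
drop-past (a ∷ A) = drop-past A

interval : ℕ → ℕ → List ℕ
interval a zero    = []
interval a (suc k) = a ∷ interval (suc a) k

interval-++ : ∀ a k l → interval a (k + l) ≡ interval a k ++ interval (a + k) l
interval-++ a zero    l = cong (λ b → interval b l) (sym (ℕ.+-identityʳ a))
interval-++ a (suc k) l = cong (a ∷_) (trans (interval-++ (suc a) k l)
                                              (cong (λ b → interval (suc a) k ++ interval b l) (sym (ℕ.+-suc a k))))

∈-interval⁻ : ∀ {e} a k → e ∈ interval a k → ∃[ i ] (i < k × e ≡ a + i)
∈-interval⁻ a (suc k) (here refl) = 0 , s≤s z≤n , sym (ℕ.+-identityʳ a)
∈-interval⁻ a (suc k) (there e∈) with ∈-interval⁻ (suc a) k e∈
... | i , i<k , refl = suc i , s≤s i<k , sym (ℕ.+-suc a i)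

∈-interval⁺ : ∀ a k {i} → i < k → a + i ∈ interval a k
∈-interval⁺ a (suc k) {zero}  _         = here (ℕ.+-identityʳ a)
∈-interval⁺ a (suc k) {suc i} (s≤s i<k) =
  there (subst (_∈ interval (suc a) k) (sym (ℕ.+-suc a i)) (∈-interval⁺ (suc a) k i<k))

interval-increasing : ∀ a k → AllPairs _<_ (interval a k)
interval-increasing a zero    = []
interval-increasing a (suc k) = All.tabulate above-a ∷ interval-increasing (suc a) k
  where
    above-a : ∀ {e} → e ∈ interval (suc a) k → a < e
    above-a e∈ with ∈-interval⁻ (suc a) k e∈
    ... | i , _ , refl = s≤s (ℕ.m≤m+n a i)

interval-pivot : ∀ a k u {j w} → interval a k ≡ u ++ j ∷ w → j ≡ a + length u
interval-pivot a (suc k) []      refl = sym (ℕ.+-identityʳ a)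
interval-pivot a (suc k) (b ∷ u) eq   =
  trans (interval-pivot (suc a) k u (proj₂ (∷-injective eq))) (sym (ℕ.+-suc a (length u)))

interval-char : ∀ a l → (∀ i → i < length l → at l (suc i) ≡ a + i) → l ≡ interval a (length l)
interval-char a []      _ = refl
interval-char a (e ∷ l) h = cong₂ _∷_ (trans (h 0 (s≤s z≤n)) (ℕ.+-identityʳ a))
  (interval-char (suc a) l (λ i i< → trans (h (suc i) (s≤s i<)) (ℕ.+-suc a i)))

applyUpTo-interval : ∀ (f : ℕ → ℕ) a k → (∀ i → f i ≡ a + i) → applyUpTo f k ≡ interval a k
applyUpTo-interval f a zero    _  = refl
applyUpTo-interval f a (suc k) fi = cong₂ _∷_ (trans (fi 0) (ℕ.+-identityʳ a))
  (applyUpTo-interval (λ i → f (suc i)) (suc a) k (λ i → trans (fi (suc i)) (ℕ.+-suc a i)))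

range-interval : ∀ a b → range a b ≡ interval a (suc b ∸ a)
range-interval a b = trans (map-upTo (a +_) (suc b ∸ a)) (applyUpTo-interval (a +_) a _ (λ _ → refl))

tlFrom-fixed : ∀ π k m → k ∸ tlFrom π k < m → m ≤ k → at π m ≡ m
tlFrom-fixed π zero    m lt le = ⊥-elim (ℕ.<⇒≱ lt le)
tlFrom-fixed π (suc k) m lt le with at π (suc k) ≟ suc k
... | no  _ = ⊥-elim (ℕ.<⇒≱ lt le)
... | yes fixed with m ≟ suc k
...   | yes refl = fixed
...   | no  m≢   = tlFrom-fixed π k m lt (ℕ.≤-pred (ℕ.≤∧≢⇒< le m≢))

tlFrom-≤ : ∀ π k → tlFrom π k ≤ k
tlFrom-≤ π zero = z≤n
tlFrom-≤ π (suc k) with at π (suc k) ≟ suc k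
... | yes _ = s≤s (tlFrom-≤ π k)
... | no  _ = z≤n

module DescentShape (n : ℕ) (π : List ℕ) (d₀ : ℕ) (π∈Sₙ : InS n π)
                    (tail-bound-descent : TailBoundDescent n π (suc d₀)) where

  d : ℕ
  d = suc d₀

  d<n : d < n
  d<n = proj₁ (proj₂ (proj₁ tail-bound-descent))

  descent : at π (suc d) < at π d
  descent = proj₂ (proj₂ (proj₁ tail-bound-descent))

  lengthπ : length π ≡ n
  lengthπ = trans (Perm.↭-length π∈Sₙ) (trans (length-map suc (upTo n)) (length-upTo n))

  distinctπ : Unique π
  distinctπ = unique-resp-↭ (↭-sym π∈Sₙ) (Unique.map⁺ ℕ.suc-injective (Unique.upTo⁺ n))

  π≤n : ∀ {e} → e ∈ π → e ≤ n
  π≤n e∈ with ∈-map⁻ suc (Perm.∈-resp-↭ π∈Sₙ e∈)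
  ... | i , i∈ , refl = ∈-upTo⁻ i∈

  ℓ c : ℕ
  ℓ = tl n π
  c = n ∸ ℓ

  c+ℓ : c + ℓ ≡ n
  c+ℓ = ℕ.m∸n+n≡m (tlFrom-≤ π n)

  fixed : ∀ j → c < j → j ≤ n → at π j ≡ j
  fixed j = tlFrom-fixed π n j

  T X : List ℕ
  T = take c π
  X = drop c π

  π≡TX : π ≡ T ++ X
  π≡TX = sym (take++drop≡id c π)

  lengthT : length T ≡ c
  lengthT = trans (length-take c π) (trans (cong (c ⊓_) lengthπ) (ℕ.m≤n⇒m⊓n≡m (ℕ.m∸n≤m n ℓ)))

  X≡interval : X ≡ interval (suc c) ℓ
  X≡interval = trans (interval-char (suc c) X entry) (cong (interval (suc c)) lengthX)
    where
      lengthX : length X ≡ ℓ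
      lengthX = trans (length-drop c π) (trans (cong (_∸ c) lengthπ) (ℕ.m∸[m∸n]≡n (tlFrom-≤ π n)))
      entry : ∀ i → i < length X → at X (suc i) ≡ suc c + i
      entry i i< = begin
        at X (suc i)                   ≡⟨ sym (at-++ʳ T X i) ⟩
        at (T ++ X) (length T + suc i) ≡⟨ cong₂ at (sym π≡TX) (cong (_+ suc i) lengthT) ⟩
        at π (c + suc i)               ≡⟨ fixed (c + suc i) (ℕ.m<m+n c (s≤s z≤n))
                                            (subst (c + suc i ≤_) c+ℓ (ℕ.+-monoʳ-≤ c (subst (suc i ≤_) lengthX i<))) ⟩
        c + suc i                      ≡⟨ ℕ.+-suc c i ⟩
        suc c + i                      ∎
        where open ≡-Reasoning

  T≤c : ∀ {e} → e ∈ T → e ≤ c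
  T≤c {e} e∈ with ℕ.≤-<-connex e c
  ... | inj₁ e≤c = e≤c
  ... | inj₂ c<e = ⊥-elim (unique-disjoint T (subst Unique π≡TX distinctπ) e∈ (subst (e ∈_) (sym X≡interval) e∈X))
    where
      e≤n = π≤n (subst (e ∈_) (sym π≡TX) (∈-++⁺ˡ e∈))
      i = e ∸ suc c
      e≡ : suc c + i ≡ e
      e≡ = ℕ.m+[n∸m]≡n c<e
      i<ℓ : i < ℓ
      i<ℓ = ℕ.+-cancelˡ-≤ c (suc i) ℓ (subst₂ _≤_ (sym (trans (ℕ.+-suc c i) e≡)) (sym c+ℓ) e≤n)
      e∈X : e ∈ interval (suc c) ℓ
      e∈X = subst (_∈ interval (suc c) ℓ) e≡ (∈-interval⁺ (suc c) ℓ i<ℓ)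

  X>c : ∀ {z} → z ∈ X → c < z
  X>c z∈ with ∈-interval⁻ (suc c) ℓ (subst (_ ∈_) X≡interval z∈)
  ... | i , _ , refl = s≤s (ℕ.m≤m+n c i)

  at-T : ∀ k → k < c → at π (suc k) ≡ at T (suc k)
  at-T k k<c = trans (cong (λ l → at l (suc k)) π≡TX) (at-++ˡ T X k (subst (k <_) (sym lengthT) k<c))

  -- The descent lies strictly before the tail: otherwise π_d ≤ d < d + 1 = π_{d+1}.
  d<c : d < c
  d<c with ℕ.<-≤-connex d c
  ... | inj₁ d<c = d<c
  ... | inj₂ c≤d = ⊥-elim (ℕ.<⇒≱ (ℕ.<-trans (ℕ.n<1+n d) d+1<πd) πd≤d)
    where
      d+1<πd : suc d < at π d
      d+1<πd = subst (_< at π d) (fixed (suc d) (s≤s c≤d) d<n) descent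
      πd≤d : at π d ≤ d
      πd≤d with ℕ.m≤n⇒m<n∨m≡n c≤d
      ... | inj₁ c<d  = ℕ.≤-reflexive (fixed d c<d (ℕ.<⇒≤ d<n))
      ... | inj₂ c≡d = subst₂ _≤_ (sym (at-T d₀ d₀<c)) c≡d (T≤c (at-∈ T d₀ (subst (d₀ <_) (sym lengthT) d₀<c)))
        where d₀<c = subst (d₀ <_) (sym c≡d) ℕ.≤-refl

  d<lengthT : d < length T
  d<lengthT = subst (d <_) (sym lengthT) d<c

  P B₁ : List ℕ
  P  = take d T
  B₁ = drop (suc d) T

  p b₀ : ℕ
  p  = at T d
  b₀ = at T (suc d)

  open Shape p b₀ B₁ using (B; Admissible)

  T≡PB : T ≡ P ++ B
  T≡PB = trans (sym (take++drop≡id d T)) (cong (P ++_) (drop-at T d d<lengthT))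

  π≡PBX : π ≡ P ++ B ++ X
  π≡PBX = trans π≡TX (trans (cong (_++ X) T≡PB) (++-assoc P B X))

  lengthP : length P ≡ d
  lengthP = trans (length-take d T) (ℕ.m≤n⇒m⊓n≡m (ℕ.<⇒≤ d<lengthT))

  d+lengthB : d + length B ≡ c
  d+lengthB = trans (cong (_+ length B) (sym lengthP))
                    (trans (sym (length-++ P)) (trans (cong length (sym T≡PB)) lengthT))

  P≡ : P ≡ take d₀ T ++ [ p ]
  P≡ = take-at d₀ T (ℕ.<-trans ℕ.≤-refl d<lengthT)

  p∈P : p ∈ P
  p∈P = subst (p ∈_) (sym P≡) (∈-++⁺ʳ (take d₀ T) (here refl))

  πd≡p : at π d ≡ p
  πd≡p = at-T d₀ (ℕ.<-trans ℕ.≤-refl d<c)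

  distinctPB : Unique (P ++ B)
  distinctPB = subst Unique T≡PB (AllPairs-++ˡ T (subst Unique π≡TX distinctπ))

  at-B : ∀ k → k < length B → at π (d + suc k) ≡ at B (suc k)
  at-B k k< = trans (cong₂ at π≡PBX (cong (_+ suc k) (sym lengthP))) (trans (at-++ʳ P (B ++ X) k) (at-++ˡ B X k k<))

  -- Tail-boundedness: an entry of B above p would force its position into the tail.
  B<p : All (_< p) B
  B<p = All.tabulate below
    where
      below : ∀ {b} → b ∈ B → b < p
      below b∈ with ∈⇒at B b∈
      ... | k , k< , refl with ℕ.<-cmp (at B (suc k)) p
      ...   | tri< b<p _ _ = b<p
      ...   | tri≈ _ b≡p _ = ⊥-elim (unique-disjoint P distinctPB p∈P (subst (_∈ B) b≡p b∈))
      ...   | tri> _ _ p<b = ⊥-elim (ℕ.<⇒≱ c<j j≤c)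
        where
          j≤c : d + suc k ≤ c
          j≤c = subst (d + suc k ≤_) d+lengthB (ℕ.+-monoʳ-≤ d k<)
          inTail = proj₂ tail-bound-descent (d + suc k) (ℕ.m<m+n d (s≤s z≤n)) (ℕ.≤-trans j≤c (ℕ.m∸n≤m n ℓ))
                     (subst₂ _<_ (sym πd≡p) (sym (at-B k k<)) p<b)
          c<j : c < d + suc k
          c<j with inTail
          ... | m , c+1≤m , _ , refl , _ = subst (_≤ m) (ℕ.+-comm c 1) c+1≤m

  admissible : Admissible P X
  admissible = record
    { ends-with-p = take d₀ T , P≡
    ; distinct    = distinctPB
    ; increasing  = subst (AllPairs _<_) (sym X≡interval) (interval-increasing (suc c) ℓ)
    ; above       = λ e∈ z∈ → ℕ.≤-<-trans (T≤c (subst (_ ∈_) (sym T≡PB) e∈)) (X>c z∈) }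

  SWd≡X : SWd n π d ≡ X
  SWd≡X = begin
    filter hook? (range (suc d) n)                                   ≡⟨ cong (filter hook?) (range-interval (suc d) n) ⟩
    filter hook? (interval (suc d) (n ∸ d))                           ≡⟨ cong (filter hook?) split ⟩
    filter hook? (interval (suc d) (length B) ++ interval (suc c) ℓ)  ≡⟨ filter-++ hook? (interval (suc d) (length B)) _ ⟩
    filter hook? (interval (suc d) (length B)) ++ filter hook? (interval (suc c) ℓ)
      ≡⟨ cong₂ _++_ (filter-none hook? (All.tabulate inB)) (filter-all hook? (All.tabulate inX)) ⟩
    interval (suc c) ℓ                                               ≡⟨ sym X≡interval ⟩
    X ∎
    where
      open ≡-Reasoning
      hook? = λ j → at π d <? at π j
      n∸d : n ∸ d ≡ length B + ℓ
      n∸d = trans (cong (_∸ d) (trans (sym c+ℓ) (trans (cong (_+ ℓ) (sym d+lengthB)) (ℕ.+-assoc d (length B) ℓ))))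
                  (ℕ.m+n∸m≡n d (length B + ℓ))
      split : interval (suc d) (n ∸ d) ≡ interval (suc d) (length B) ++ interval (suc c) ℓ
      split = trans (cong (interval (suc d)) n∸d)
                    (trans (interval-++ (suc d) (length B) ℓ)
                           (cong (λ a → interval (suc d) (length B) ++ interval (suc a) ℓ) d+lengthB))
      inB : ∀ {j} → j ∈ interval (suc d) (length B) → ¬ (at π d < at π j)
      inB j∈ with ∈-interval⁻ (suc d) (length B) j∈
      ... | k , k< , refl = ℕ.<⇒≯ (subst₂ _<_ (sym (trans (cong (at π) (sym (ℕ.+-suc d k))) (at-B k k<))) (sym πd≡p)
                                             (All.lookup B<p (at-∈ B k k<)))
      inX : ∀ {j} → j ∈ interval (suc c) ℓ → at π d < at π j
      inX j∈ with ∈-interval⁻ (suc c) ℓ j∈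
      ... | i , i< , refl = subst₂ _<_ (sym πd≡p) (sym (fixed (suc c + i) (s≤s (ℕ.m≤m+n c i))
                                (subst (suc c + i ≤_) c+ℓ (subst (_≤ c + ℓ) (ℕ.+-suc c i) (ℕ.+-monoʳ-≤ c i<)))))
                              (ℕ.≤-<-trans (T≤c (subst (p ∈_) (sym T≡PB) (∈-++⁺ˡ p∈P))) (s≤s (ℕ.m≤m+n c i)))

  module _ {t : Pivot} (t∈ : t ∈ pivots X) where
    private
      TU : List ℕ
      TU = T ++ left t
      π≡ : π ≡ TU ++ point t ∷ right t
      π≡ = trans π≡TX (trans (cong (T ++_) (sym (∈-pivots⁻ X t∈))) (sym (++-assoc T (left t) _)))
      j≡ : point t ≡ suc (length TU)
      j≡ = trans (interval-pivot (suc c) ℓ (left t) (trans (sym X≡interval) (sym (∈-pivots⁻ X t∈))))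
                 (cong suc (trans (cong (_+ length (left t)) (sym lengthT)) (sym (length-++ T))))

    πU≡ : πU π d (point t) ≡ P ++ right t
    πU≡ = cong₂ _++_ (trans (cong₂ take (sym lengthP) π≡PBX) (take-length-++ P (B ++ X)))
                     (trans (cong₂ drop j≡ π≡) (drop-past TU))

    πS≡ : πS π d (point t) ≡ B ++ left t
    πS≡ = begin
      drop d (take (point t ∸ 1) π)                       ≡⟨ cong₂ (λ k l → drop d (take k l)) (cong (_∸ 1) j≡) π≡ ⟩
      drop d (take (length TU) (TU ++ point t ∷ right t)) ≡⟨ cong (drop d) (take-length-++ TU _) ⟩
      drop d (T ++ left t)                                ≡⟨ cong₂ (λ k l → drop k (l ++ left t)) (sym lengthP) T≡PB ⟩
      drop (length P) ((P ++ B) ++ left t)                ≡⟨ cong (drop (length P)) (++-assoc P B (left t)) ⟩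
      drop (length P) (P ++ B ++ left t)                  ≡⟨ drop-length-++ P (B ++ left t) ⟩
      B ++ left t                                         ∎
      where open ≡-Reasoning

lemma1 : (n : ℕ) (π : List ℕ) (d : ℕ) → InS n π → TailBoundDescent n π d →
    (R : CommutativeSemiring 0ℓ 0ℓ) (x y : CommutativeSemiring.Carrier R) →
    CommutativeSemiring._≈_ R (Poly.F R x y π)
      (Poly.sumR R (map (λ j → CommutativeSemiring._*_ R (Poly.F R x y (πU π d j)) (Poly.F R x y (πS π d j))) (SWd n π d)))
lemma1 n π zero     _     ((() , _) , _) R x y
lemma1 n π (suc d₀) π∈Sₙ tbd               R x y = begin
  F π                                                ≡⟨ cong F π≡PBX ⟩
  F (P ++ B ++ X)                                    ≈⟨ factorise (length X) P X ℕ.≤-refl admissible ⟩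
  ∑ (λ t → F (P ++ right t) ⊗ F (B ++ left t)) (pivots X)
    ≈⟨ ∑-cong (pivots X) (λ t∈ → reflexive (sym (cong₂ (λ U S → F U ⊗ F S) (πU≡ t∈) (πS≡ t∈)))) ⟩
  ∑ (λ t → hookTerm (point t)) (pivots X)            ≈⟨ ≈-sym (∑-map hookTerm point (pivots X)) ⟩
  ∑ hookTerm (map point (pivots X))                  ≡⟨ cong (∑ hookTerm) (trans (map-point-pivots X) (sym SWd≡X)) ⟩
  ∑ hookTerm (SWd n π (suc d₀))                      ∎
  where
    open CommutativeSemiring R using (Carrier; reflexive)
      renaming (_*_ to _⊗_; sym to ≈-sym; setoid to ≈-setoid)
    open import Relation.Binary.Reasoning.Setoid ≈-setoid
    open DescentShape n π d₀ π∈Sₙ tbd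
    open Shape p b₀ B₁ using (B)
    open Sums R using (∑; ∑-cong; ∑-map)
    open GeneratingFunction R x y using (F)
    open Factorisation R x y p b₀ B₁ B<p using (factorise)
    hookTerm : ℕ → Carrier
    hookTerm j = F (πU π (suc d₀) j) ⊗ F (πS π (suc d₀) j)
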